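{- For every context $\Gamma$, variable $x$ and term $A$: if $\Gamma\ \mathrm{ok}$ and $(x,A)\in\Gamma$, then there exists $s\in\mathcal{C}$ with $\Gamma\vdash A:\mathsf{c}\,s$.
   Context: Variables $\mathcal{V}$: a type with decidable equality and maps $\mathrm{encode}:\mathcal{V}\to\mathbb{N}$, $\mathrm{decode}:\mathbb{N}\to\mathcal{V}$ with $\mathrm{encode}(\mathrm{decode}\,n)=n$. Constants $\mathcal{C}$: any type. Terms: $\mathsf{c}\,k$, $\mathsf{v}\,x$, $\lambda[x:A]M$, $\Pi[x:A]B$, $M\cdot N$. Free-variable list: $\mathrm{fv}(\mathsf{c}\,k)=[\,]$, $\mathrm{fv}(\mathsf{v}\,x)=[x]$, $\mathrm{fv}(\lambda[x:A]M)=\mathrm{fv}\,A\mathbin{++}(\mathrm{fv}\,M-x)$, likewise $\Pi$, $\mathrm{fv}(M\cdot N)=\mathrm{fv}\,M\mathbin{++}\mathrm{fv}\,N$ ($xs-x$ removes all occurrences of $x$). Substitutions $\sigma:\mathcal{V}\to\Lambda$; $\iota\,x=\mathsf{v}\,x$; $(\sigma,x:=N)$ sends $x$ to $N$, $y\neq x$ to $\sigma\,y$. Fix $\chi':\mathrm{List}\,\mathbb{N}\to\mathbb{N}$ with $\chi'(ns)\notin ns$; $X'(xs)=\mathrm{decode}(\chi'(\mathrm{map\ encode}\ xs))$; $X(\sigma,xs)=X'$(concatenation of $\mathrm{fv}(\sigma\,y)$ for $y$ in $xs$). Substitution: $\mathsf{c}\,k\bullet\sigma=\mathsf{c}\,k$,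 $\mathsf{v}\,x\bullet\sigma=\sigma\,x$, $(M\cdot N)\bullet\sigma=(M\bullet\sigma)\cdot(N\bullet\sigma)$, $(\lambda[x:A]M)\bullet\sigma=\lambda[y:A\bullet\sigma](M\bullet(\sigma,x:=\mathsf{v}\,y))$ with $y=X(\sigma,\mathrm{fv}\,M-x)$, analogously for $\Pi$ (with $y=X(\sigma,\mathrm{fv}\,B-x)$). $M[x:=N]=M\bullet(\iota,x:=N)$. Alpha-conversion $\sim_\alpha$: inductive, $\mathsf{c}\,k\sim_\alpha\mathsf{c}\,k$, $\mathsf{v}\,x\sim_\alpha\mathsf{v}\,x$, congruence for application, and $\lambda[x:A]M\sim_\alpha\lambda[x':A']M'$ whenever $A\sim_\alpha A'$, $y\notin\mathrm{fv}\,M-x$, $y\notin\mathrm{fv}\,M'-x'$ and $M[x:=\mathsf{v}\,y]=M'[x':=\mathsf{v}\,y]$ syntactically, for some $y$ (same for $\Pi$). Beta: the contextual closure of a relation $S$ is the least relation containing $S$ and closed under rewriting in the body or annotation of $\lambda$, in the codomain or domain of $\Pi$, and in either side of an application; $\to_\beta$ is the contextual closure of $(\lambda[x:A]M)\cdot N\ \triangleright\ M[x:=N]$; $\simeq_\beta$ is the reflexive–symmetric–transitive closure of $\sim_\alpha\cup\to_\beta$. PTS: fix $\mathcal{A}\subseteq\mathcal{C}^2$ (axioms) and $\mathcal{R}\subseteq\mathcal{C}^3$ (rules). A context is a list of pairs $(x,A)$; $\Gamma,x:A$ denotes $(x,A)::\Gamma$; $\mathrm{dom}\,\Gamma$ is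 the list of first components. The judgments $\Gamma\ \mathrm{ok}$ and $\Gamma\vdash M:A$ are mutually inductively defined by: (nil) $[\,]\ \mathrm{ok}$; (cons) if $\Gamma\ \mathrm{ok}$, $\Gamma\vdash A:\mathsf{c}\,s$ and $x\notin\mathrm{dom}\,\Gamma$ then $(\Gamma,x:A)\ \mathrm{ok}$; (sort) if $\Gamma\ \mathrm{ok}$ and $\mathcal{A}\,s_1\,s_2$ then $\Gamma\vdash\mathsf{c}\,s_1:\mathsf{c}\,s_2$; (prod) if $\Gamma\vdash A:\mathsf{c}\,s_1$, for every $y\notin\mathrm{dom}\,\Gamma$ we have $\Gamma,y:A\vdash B[x:=\mathsf{v}\,y]:\mathsf{c}\,s_2$, and $\mathcal{R}\,s_1\,s_2\,s_3$, then $\Gamma\vdash\Pi[x:A]B:\mathsf{c}\,s_3$; (var) if $\Gamma\ \mathrm{ok}$ and $(x,A)\in\Gamma$ then $\Gamma\vdash\mathsf{v}\,x:A$; (abs) if $\Gamma\vdash A:\mathsf{c}\,s_1$, for every $z\notin\mathrm{dom}\,\Gamma$ both $\Gamma,z:A\vdash B[y:=\mathsf{v}\,z]:\mathsf{c}\,s_2$ and $\Gamma,z:A\vdash M[x:=\mathsf{v}\,z]:B[y:=\mathsf{v}\,z]$, and $\mathcal{R}\,s_1\,s_2\,s_3$, then $\Gamma\vdash\lambda[x:A]M:\Pi[y:A]B$; (app) if $\Gamma\vdash M:\Pi[x:A]B$, $\Gamma\vdash N:A$ and $\Gamma\vdash B[x:=N]:\mathsf{c}\,s$, then $\Gamma\vdash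 M\cdot N:B[x:=N]$; (conv) if $\Gamma\vdash M:A$, $A\simeq_\beta B$ and $\Gamma\vdash B:\mathsf{c}\,s$ then $\Gamma\vdash M:B$. -}

module Defs where

open import Level using (Level; _⊔_; suc)
open import Data.Nat using (ℕ)
open import Data.List using (List; []; _∷_; _++_; map; concatMap; filterᵇ)
open import Data.List.Membership.Propositional using (_∈_; _∉_)
open import Data.Product using (_×_; _,_; proj₁; ∃)
open import Data.Bool using (Bool; true; false; if_then_else_)
open import Relation.Nullary using (¬_; Dec; yes; no; does)
open import Relation.Binary.PropositionalEquality using (_≡_)
open import Relation.Binary using (DecidableEquality)
open import Relation.Binary.Construct.Closure.Equivalence using (EqClosure)
open import Data.Sum using (_⊎_)

module PTS {a b ℓ₁ ℓ₂ : Level}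
  (V : Set a) (_≟V_ : DecidableEquality V)
  (encode : V → ℕ) (decode : ℕ → V)
  (encode-decode : ∀ n → encode (decode n) ≡ n)
  (C : Set b)
  (χ' : List ℕ → ℕ) (χ'-fresh : ∀ ns → χ' ns ∉ ns)
  (Ax : C → C → Set ℓ₁)
  (Rl : C → C → C → Set ℓ₂)
  where

  infixl 7 _·_
  infix 8 _[_≔_]
  infix 4 _⊢_∶_
  infix 4 _~α_ _→β_ _≃β_
  infixl 5 _,,_∶_
  infix 4 _ok

  data Λ : Set (a ⊔ b) where
    c    : C → Λ
    v    : V → Λ
    lam  : V → Λ → Λ → Λ   -- lam x A M  =  λ[x:A]M
    pi   : V → Λ → Λ → Λ   -- pi x A B   =  Π[x:A]B
    _·_  : Λ → Λ → Λ

  _-_ : List V → V → List V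
  xs - x = filterᵇ (λ y → if does (y ≟V x) then false else true) xs

  fv : Λ → List V
  fv (c k)       = []
  fv (v x)       = x ∷ []
  fv (lam x A M) = fv A ++ (fv M - x)
  fv (pi x A B)  = fv A ++ (fv B - x)
  fv (M · N)     = fv M ++ fv N

  Subst : Set (a ⊔ b)
  Subst = V → Λ

  ι : Subst
  ι x = v x

  _,_≔_ : Subst → V → Λ → Subst
  (σ , x ≔ N) y with y ≟V x
  ... | yes _ = N
  ... | no  _ = σ y

  X' : List V → V
  X' xs = decode (χ' (map encode xs))

  X : Subst → List V → V
  X σ xs = X' (concatMap (λ y → fv (σ y)) xs)

  _•_ : Λ → Subst → Λ
  c k       • σ = c k
  v x       • σ = σ x
  (M · N)   • σ = (M • σ) · (N • σ)
  lam x A M • σ = let y = X σ (fv M - x) in lam y (A • σ) (M • (σ , x ≔ v y))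
  pi x A B  • σ = let y = X σ (fv B - x) in pi y (A • σ) (B • (σ , x ≔ v y))

  _[_≔_] : Λ → V → Λ → Λ
  M [ x ≔ N ] = M • (ι , x ≔ N)

  data _~α_ : Λ → Λ → Set (a ⊔ b) where
    α-c   : ∀ {k} → c k ~α c k
    α-v   : ∀ {x} → v x ~α v x
    α-app : ∀ {M M' N N'} → M ~α M' → N ~α N' → (M · N) ~α (M' · N')
    α-lam : ∀ {x x' A A' M M'} (y : V) → A ~α A' →
            y ∉ (fv M - x) → y ∉ (fv M' - x') →
            M [ x ≔ v y ] ≡ M' [ x' ≔ v y ] →
            lam x A M ~α lam x' A' M'
    α-pi  : ∀ {x x' A A' B B'} (y : V) → A ~α A' →
            y ∉ (fv B - x) → y ∉ (fv B' - x') →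
            B [ x ≔ v y ] ≡ B' [ x' ≔ v y ] →
            pi x A B ~α pi x' A' B'

  data Ctx {ℓ : Level} (S : Λ → Λ → Set ℓ) : Λ → Λ → Set (a ⊔ b ⊔ ℓ) where
    base  : ∀ {M N} → S M N → Ctx S M N
    lamB  : ∀ {x A M M'} → Ctx S M M' → Ctx S (lam x A M) (lam x A M')
    lamA  : ∀ {x A A' M} → Ctx S A A' → Ctx S (lam x A M) (lam x A' M)
    piB   : ∀ {x A B B'} → Ctx S B B' → Ctx S (pi x A B) (pi x A B')
    piA   : ∀ {x A A' B} → Ctx S A A' → Ctx S (pi x A B) (pi x A' B)
    appL  : ∀ {M M' N} → Ctx S M M' → Ctx S (M · N) (M' · N)
    appR  : ∀ {M N N'} → Ctx S N N' → Ctx S (M · N) (M · N')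

  data β-redex : Λ → Λ → Set (a ⊔ b) where
    β : ∀ {x A M N} → β-redex (lam x A M · N) (M [ x ≔ N ])

  _→β_ : Λ → Λ → Set (a ⊔ b)
  _→β_ = Ctx β-redex

  _α∪β_ : Λ → Λ → Set (a ⊔ b)
  M α∪β N = (M ~α N) ⊎ (M →β N)

  _≃β_ : Λ → Λ → Set (a ⊔ b)
  _≃β_ = EqClosure _α∪β_

  Context : Set (a ⊔ b)
  Context = List (V × Λ)

  dom : Context → List V
  dom Γ = map proj₁ Γ

  _,,_∶_ : Context → V → Λ → Context
  Γ ,, x ∶ A = (x , A) ∷ Γ

  data _ok : Context → Set (a ⊔ b ⊔ ℓ₁ ⊔ ℓ₂)
  data _⊢_∶_ : Context → Λ → Λ → Set (a ⊔ b ⊔ ℓ₁ ⊔ ℓ₂)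

  data _ok where
    ok-nil  : [] ok
    ok-cons : ∀ {Γ x A s} → Γ ok → Γ ⊢ A ∶ c s → x ∉ dom Γ → (Γ ,, x ∶ A) ok

  data _⊢_∶_ where
    t-sort : ∀ {Γ s₁ s₂} → Γ ok → Ax s₁ s₂ → Γ ⊢ c s₁ ∶ c s₂
    t-prod : ∀ {Γ x A B s₁ s₂ s₃} → Γ ⊢ A ∶ c s₁ →
             (∀ y → y ∉ dom Γ → (Γ ,, y ∶ A) ⊢ B [ x ≔ v y ] ∶ c s₂) →
             Rl s₁ s₂ s₃ → Γ ⊢ pi x A B ∶ c s₃
    t-var  : ∀ {Γ x A} → Γ ok → (x , A) ∈ Γ → Γ ⊢ v x ∶ A
    t-abs  : ∀ {Γ x y A B M s₁ s₂ s₃} → Γ ⊢ A ∶ c s₁ →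
             (∀ z → z ∉ dom Γ → (Γ ,, z ∶ A) ⊢ B [ y ≔ v z ] ∶ c s₂) →
             (∀ z → z ∉ dom Γ → (Γ ,, z ∶ A) ⊢ M [ x ≔ v z ] ∶ B [ y ≔ v z ]) →
             Rl s₁ s₂ s₃ → Γ ⊢ lam x A M ∶ pi y A B
    t-app  : ∀ {Γ M N x A B s} → Γ ⊢ M ∶ pi x A B → Γ ⊢ N ∶ A →
             Γ ⊢ B [ x ≔ N ] ∶ c s → Γ ⊢ M · N ∶ B [ x ≔ N ]
    t-conv : ∀ {Γ M A B s} → Γ ⊢ M ∶ A → A ≃β B → Γ ⊢ B ∶ c s → Γ ⊢ M ∶ B

-- Weakening along context inclusion carries the typing A : c s, recorded when (x , A)
-- was added to the context, to every extension of that context. Inclusion rather than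
-- prefix is the right invariant: the binder rules (prod, abs) quantify over variables
-- fresh for the larger context, which are fresh for the smaller one too.
module Submission where

open import Defs
open import Level using (Level)
open import Data.Nat using (ℕ)
open import Data.List using (List)
open import Data.List.Membership.Propositional using (_∈_; _∉_)
open import Data.List.Relation.Binary.Subset.Propositional using (_⊆_)
open import Data.List.Relation.Binary.Subset.Propositional.Properties
  using (map⁺; xs⊆x∷xs; ∷⁺ʳ)
open import Data.List.Relation.Unary.Any using (here; there)
open import Data.Product using (∃; _,_; proj₁)
open import Relation.Binary using (DecidableEquality)
open import Relation.Binary.PropositionalEquality using (_≡_; refl)

module Weakening {a b ℓ₁ ℓ₂ : Level}
    (V : Set a) (_≟V_ : DecidableEquality V)
    (encode : V → ℕ) (decode : ℕ → V)
    (encode-decode : ∀ n → encode (decode n) ≡ n)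
    (C : Set b)
    (χ' : List ℕ → ℕ) (χ'-fresh : ∀ ns → χ' ns ∉ ns)
    (Ax : C → C → Set ℓ₁) (Rl : C → C → C → Set ℓ₂) where
  open PTS V _≟V_ encode decode encode-decode C χ' χ'-fresh Ax Rl

  ∉-dom-⊆ : ∀ {Γ Δ y} → Γ ⊆ Δ → y ∉ dom Δ → y ∉ dom Γ
  ∉-dom-⊆ Γ⊆Δ y∉Δ y∈Γ = y∉Δ (map⁺ proj₁ Γ⊆Δ y∈Γ)

  ⊢-weaken : ∀ {Γ Δ M T} → Γ ⊢ M ∶ T → Γ ⊆ Δ → Δ ok → Δ ⊢ M ∶ T
  ⊢-weaken-binder : ∀ {Γ Δ A s} {N T : V → Λ} →
    (∀ y → y ∉ dom Γ → (Γ ,, y ∶ A) ⊢ N y ∶ T y) → Γ ⊆ Δ → Δ ok → Δ ⊢ A ∶ c s →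
    ∀ y → y ∉ dom Δ → (Δ ,, y ∶ A) ⊢ N y ∶ T y

  ⊢-weaken (t-sort _ ax)      Γ⊆Δ Δ-ok = t-sort Δ-ok ax
  ⊢-weaken (t-var _ x∈Γ)      Γ⊆Δ Δ-ok = t-var Δ-ok (Γ⊆Δ x∈Γ)
  ⊢-weaken (t-prod ⊢A ⊢B r)   Γ⊆Δ Δ-ok = t-prod ⊢A′ (⊢-weaken-binder ⊢B Γ⊆Δ Δ-ok ⊢A′) r
    where ⊢A′ = ⊢-weaken ⊢A Γ⊆Δ Δ-ok
  ⊢-weaken (t-abs ⊢A ⊢B ⊢M r) Γ⊆Δ Δ-ok =
    t-abs ⊢A′ (⊢-weaken-binder ⊢B Γ⊆Δ Δ-ok ⊢A′) (⊢-weaken-binder ⊢M Γ⊆Δ Δ-ok ⊢A′) r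
    where ⊢A′ = ⊢-weaken ⊢A Γ⊆Δ Δ-ok
  ⊢-weaken (t-app ⊢M ⊢N ⊢B)   Γ⊆Δ Δ-ok =
    t-app (⊢-weaken ⊢M Γ⊆Δ Δ-ok) (⊢-weaken ⊢N Γ⊆Δ Δ-ok) (⊢-weaken ⊢B Γ⊆Δ Δ-ok)
  ⊢-weaken (t-conv ⊢M A≃B ⊢B) Γ⊆Δ Δ-ok =
    t-conv (⊢-weaken ⊢M Γ⊆Δ Δ-ok) A≃B (⊢-weaken ⊢B Γ⊆Δ Δ-ok)

  ⊢-weaken-binder ⊢N Γ⊆Δ Δ-ok ⊢A y y∉Δ =
    ⊢-weaken (⊢N y (∉-dom-⊆ Γ⊆Δ y∉Δ)) (∷⁺ʳ _ Γ⊆Δ) (ok-cons Δ-ok ⊢A y∉Δ)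

  ⊢-weaken-∷ : ∀ {Γ y B M T} → Γ ⊢ M ∶ T → (Γ ,, y ∶ B) ok → (Γ ,, y ∶ B) ⊢ M ∶ T
  ⊢-weaken-∷ ⊢M = ⊢-weaken ⊢M (xs⊆x∷xs _ _)

  ok-∈⇒sort : ∀ {Γ x A} → Γ ok → (x , A) ∈ Γ → ∃ λ s → Γ ⊢ A ∶ c s
  ok-∈⇒sort Γ-ok@(ok-cons {s = s} _ ⊢A _) (here refl) = s , ⊢-weaken-∷ ⊢A Γ-ok
  ok-∈⇒sort Γ-ok@(ok-cons Δ-ok _ _) (there x∈Δ) with ok-∈⇒sort Δ-ok x∈Δ
  ... | s , ⊢A = s , ⊢-weaken-∷ ⊢A Γ-ok

lemma16 : ∀ {a b ℓ₁ ℓ₂ : Level}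
    (V : Set a) (_≟V_ : DecidableEquality V)
    (encode : V → ℕ) (decode : ℕ → V)
    (encode-decode : ∀ n → encode (decode n) ≡ n)
    (C : Set b)
    (χ' : List ℕ → ℕ) (χ'-fresh : ∀ ns → χ' ns ∉ ns)
    (Ax : C → C → Set ℓ₁) (Rl : C → C → C → Set ℓ₂) →
    let open PTS V _≟V_ encode decode encode-decode C χ' χ'-fresh Ax Rl in
    ∀ (Γ : Context) (x : V) (A : Λ) → Γ ok → (x , A) ∈ Γ →
    ∃ λ (s : C) → Γ ⊢ A ∶ c s
lemma16 V _≟V_ encode decode encode-decode C χ' χ'-fresh Ax Rl Γ x A =
  Weakening.ok-∈⇒sort V _≟V_ encode decode encode-decode C χ' χ'-fresh Ax Rl
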